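{- Every set $\mathcal{A}$ of $\mathcal{L}_T$ sentences that is $\mathbf{FIX}$-definable (by some formula of $\mathcal{L}_\Box$ whose only variable is $x$) is defined over $\mathbf{FIX}$ by a (possibly empty) disjunction of intensional 1-isolators for $\mathbf{S5[Con,Ground]}$, where the empty disjunction is a contradiction.
   Context: Kripke fixed points. $\mathcal{L}_T$ is first-order arithmetic plus a unary predicate $\mathsf{True}$, with standard Gödel numbering $\ulcorner\cdot\urcorner$. Sentences are evaluated in strong Kleene logic $\mathsf{K3}$ (values \textsc{true}, \textsc{false}, \textsc{neither}; $\wedge$ true iff both true, false iff one false; $\neg$ swaps true/false; $\forall$ true iff all instances true, false iff some instance false; otherwise neither). For $S\subseteq\mathbb{N}$, $\mathbb{N}_S$ interprets arithmetic standardly and makes $\mathsf{True}(n)$ true iff $n\in S$, false iff $n$ is not a sentence code or $n=\ulcorner\varphi\urcorner$ with $\ulcorner\neg\varphi\urcorner\in S$, neither otherwise. A fixed point is a set $S$ of sentence codes with $S=\{\ulcorner\varphi\urcorner:\varphi\text{ true in }\mathbb{N}_S\}$ and no $\varphi$ with both $\ulcorner\varphi\urcorner,\ulcorner\neg\varphi\urcorner\in S$; values in $S$ are values in $\mathbb{N}_S$. $\mathbf{FIX}$ is the set of fixed points. Modal language and semantics. $\mathcal{L}_\Box$: formulas $\varphi::=T(x)\mid F(x)\mid\neg\varphi\mid(\varphi\wedge\varphi)\mid\Box\varphi$ over countably many variables; $\lozenge$ etc. abbreviations; $N(x):=\neg T(x)\wedge\neg F(x)$. A realization $\star$ assigns each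 variable $x$ an $\mathcal{L}_T$ sentence $x^\star$. For $w\in\mathbf{FIX}$: $w\Vdash_\star T(x)$ iff $x^\star$ is \textsc{true} in $w$; $w\Vdash_\star F(x)$ iff $x^\star$ is \textsc{false} in $w$; Boolean connectives classical; $w\Vdash_\star\Box\varphi$ iff $v\Vdash_\star\varphi$ for all $v\in\mathbf{FIX}$. $\mathbf{FIX}\Vdash_\star\varphi$ means $w\Vdash_\star\varphi$ for all $w\in\mathbf{FIX}$. A formula $\varphi(x)$ defines a set $\mathcal{A}$ of $\mathcal{L}_T$ sentences over $\mathbf{FIX}$ if for every realization $\star$: $\mathbf{FIX}\Vdash_\star\varphi(x)$ iff $x^\star\in\mathcal{A}$. Axioms. $\mathbf{S5}$: least set containing all substitution instances of propositional tautologies and instances of $\Box(A\to B)\to(\Box A\to\Box B)$, $\Box A\to A$, $\lozenge A\to\Box\lozenge A$, closed under modus ponens and necessitation. $\mathbf{S5[Con,Ground]}$ adds for each variable $y$ the axioms $\neg(T(y)\wedge F(y))$ and $(\lozenge T(y)\wedge\lozenge F(y))\to\lozenge N(y)$. Isolators. A formula is intensional if every occurrence of a variable in it lies in the scope of a $\Box$. For a system $\Sigma$ and set $\Gamma$ of formulas, $\varphi$ is $\Gamma$-maximal for $\Sigma$ if $\Sigma+\varphi$ is consistent, $\varphi\in\Gamma$, and for every $\psi\in\Gamma$ either $\Sigma\vdash\varphi\to\psi$ or $\Sigma\vdash\varphi\to\neg\psi$. The intensional 1-isolators for $\Sigma$ are the $\Gamma$-maximal formulas for $\Sigma$ where $\Gamma$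 is the set of intensional formulas whose only variable is $x$. -}

module Defs where

open import Level using (Level; Lift; lift; 0ℓ) renaming (suc to lsuc)
open import Data.Nat using (ℕ; zero; suc; _+_; _*_; _^_)
open import Data.Fin using (Fin; toℕ) renaming (zero to fzero; suc to fsuc)
open import Data.Product using (Σ; _×_; _,_; ∃)
open import Data.Sum using (_⊎_)
open import Data.Empty using (⊥)
open import Data.Unit using (⊤)
open import Data.Bool using (Bool; true; false; not; _∧_)
open import Data.List using (List; []; _∷_)
open import Data.List.Relation.Unary.All using (All)
open import Relation.Nullary using (¬_)
open import Relation.Binary.PropositionalEquality using (_≡_)
open import Function.Bundles using (_⇔_)

-- The language L_T: first-order arithmetic (0, S, +, ×, =) plus True.
-- Terms/formulas are indexed by the number of free (de Bruijn) variables;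
-- sentences are formulas with no free variables.

data Tm (n : ℕ) : Set where
  var  : Fin n → Tm n
  zer  : Tm n
  sc   : Tm n → Tm n
  plus : Tm n → Tm n → Tm n
  mult : Tm n → Tm n → Tm n

data Fm (n : ℕ) : Set where
  eq    : Tm n → Tm n → Fm n
  True  : Tm n → Fm n
  neg   : Fm n → Fm n
  conj  : Fm n → Fm n → Fm n
  all   : Fm (suc n) → Fm n

Sentence : Set
Sentence = Fm 0

⟪_,_⟫ : ℕ → ℕ → ℕ
⟪ a , b ⟫ = (2 ^ a) * (2 * b + 1)

codeTm : ∀ {n} → Tm n → ℕ
codeTm (var i)    = ⟪ 0 , toℕ i ⟫
codeTm zer        = ⟪ 1 , 0 ⟫
codeTm (sc t)     = ⟪ 2 , codeTm t ⟫
codeTm (plus t u) = ⟪ 3 , ⟪ codeTm t , codeTm u ⟫ ⟫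
codeTm (mult t u) = ⟪ 4 , ⟪ codeTm t , codeTm u ⟫ ⟫

code : ∀ {n} → Fm n → ℕ
code (eq t u)   = ⟪ 0 , ⟪ codeTm t , codeTm u ⟫ ⟫
code (True t)   = ⟪ 1 , codeTm t ⟫
code (neg φ)    = ⟪ 2 , code φ ⟫
code (conj φ ψ) = ⟪ 3 , ⟪ code φ , code ψ ⟫ ⟫
code (all φ)    = ⟪ 4 , code φ ⟫

IsSentenceCode : ℕ → Set
IsSentenceCode m = Σ Sentence (λ φ → code φ ≡ m)

-- Strong Kleene (K3) evaluation in N_S, for S ⊆ ℕ (a predicate on ℕ).
-- A sentence is TRUE if Tr holds, FALSE if Fa holds, NEITHER otherwise.

Env : ℕ → Set
Env n = Fin n → ℕ

_∷ᵉ_ : ∀ {n} → ℕ → Env n → Env (suc n)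
(m ∷ᵉ ρ) fzero    = m
(m ∷ᵉ ρ) (fsuc i) = ρ i

⟦_⟧ : ∀ {n} → Tm n → Env n → ℕ
⟦ var i ⟧ ρ    = ρ i
⟦ zer ⟧ ρ      = 0
⟦ sc t ⟧ ρ     = suc (⟦ t ⟧ ρ)
⟦ plus t u ⟧ ρ = ⟦ t ⟧ ρ + ⟦ u ⟧ ρ
⟦ mult t u ⟧ ρ = ⟦ t ⟧ ρ * ⟦ u ⟧ ρ

TrueAt : (ℕ → Set) → ℕ → Set
TrueAt S m = S m

FalseAt : (ℕ → Set) → ℕ → Set
FalseAt S m = (¬ IsSentenceCode m) ⊎ Σ Sentence (λ φ → code φ ≡ m × S (code (neg φ)))

mutual
  Tr : (S : ℕ → Set) → ∀ {n} → Env n → Fm n → Set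
  Tr S ρ (eq t u)   = ⟦ t ⟧ ρ ≡ ⟦ u ⟧ ρ
  Tr S ρ (True t)   = TrueAt S (⟦ t ⟧ ρ)
  Tr S ρ (neg φ)    = Fa S ρ φ
  Tr S ρ (conj φ ψ) = Tr S ρ φ × Tr S ρ ψ
  Tr S ρ (all φ)    = (m : ℕ) → Tr S (m ∷ᵉ ρ) φ

  Fa : (S : ℕ → Set) → ∀ {n} → Env n → Fm n → Set
  Fa S ρ (eq t u)   = ¬ (⟦ t ⟧ ρ ≡ ⟦ u ⟧ ρ)
  Fa S ρ (True t)   = FalseAt S (⟦ t ⟧ ρ)
  Fa S ρ (neg φ)    = Tr S ρ φ
  Fa S ρ (conj φ ψ) = Fa S ρ φ ⊎ Fa S ρ ψ
  Fa S ρ (all φ)    = Σ ℕ (λ m → Fa S (m ∷ᵉ ρ) φ)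

emptyEnv : Env 0
emptyEnv ()

TrueIn : (ℕ → Set) → Sentence → Set
TrueIn S φ = Tr S emptyEnv φ

FalseIn : (ℕ → Set) → Sentence → Set
FalseIn S φ = Fa S emptyEnv φ

IsFixedPoint : (ℕ → Set) → Set
IsFixedPoint S =
  ((m : ℕ) → S m ⇔ Σ Sentence (λ φ → code φ ≡ m × TrueIn S φ))
  × ((φ : Sentence) → ¬ (S (code φ) × S (code (neg φ))))

FIX : Set₁
FIX = Σ (ℕ → Set) IsFixedPoint

data MForm : Set where
  T    : ℕ → MForm
  F    : ℕ → MForm
  ¬ₘ_  : MForm → MForm
  _∧ₘ_ : MForm → MForm → MForm
  □_   : MForm → MForm

x : ℕ
x = 0

_∨ₘ_ : MForm → MForm → MForm
φ ∨ₘ ψ = ¬ₘ ((¬ₘ φ) ∧ₘ (¬ₘ ψ))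

_⇒ₘ_ : MForm → MForm → MForm
φ ⇒ₘ ψ = ¬ₘ (φ ∧ₘ (¬ₘ ψ))

◇_ : MForm → MForm
◇ φ = ¬ₘ (□ (¬ₘ φ))

Nₘ : ℕ → MForm
Nₘ y = (¬ₘ (T y)) ∧ₘ (¬ₘ (F y))

⊥ₘ : MForm
⊥ₘ = T x ∧ₘ (¬ₘ (T x))

⋁ : List MForm → MForm
⋁ []       = ⊥ₘ
⋁ (φ ∷ φs) = φ ∨ₘ ⋁ φs

Realization : Set
Realization = ℕ → Sentence

_⊩[_]_ : FIX → Realization → MForm → Set₁
(S , _) ⊩[ ⋆ ] T y    = Lift (lsuc 0ℓ) (TrueIn S (⋆ y))
(S , _) ⊩[ ⋆ ] F y    = Lift (lsuc 0ℓ) (FalseIn S (⋆ y))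
w ⊩[ ⋆ ] (¬ₘ φ)       = ¬ (w ⊩[ ⋆ ] φ)
w ⊩[ ⋆ ] (φ ∧ₘ ψ)     = (w ⊩[ ⋆ ] φ) × (w ⊩[ ⋆ ] ψ)
w ⊩[ ⋆ ] (□ φ)        = (v : FIX) → v ⊩[ ⋆ ] φ

FIX⊩[_]_ : Realization → MForm → Set₁
FIX⊩[ ⋆ ] φ = (w : FIX) → w ⊩[ ⋆ ] φ

Defines : MForm → (Sentence → Set₁) → Set₁
Defines φ 𝒜 = (⋆ : Realization) → (FIX⊩[ ⋆ ] φ) ⇔ 𝒜 (⋆ x)

OnlyVarX : MForm → Set
OnlyVarX (T y)    = y ≡ x
OnlyVarX (F y)    = y ≡ x
OnlyVarX (¬ₘ φ)   = OnlyVarX φ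
OnlyVarX (φ ∧ₘ ψ) = OnlyVarX φ × OnlyVarX ψ
OnlyVarX (□ φ)    = OnlyVarX φ

Intensional : MForm → Set
Intensional (T y)    = ⊥
Intensional (F y)    = ⊥
Intensional (¬ₘ φ)   = Intensional φ
Intensional (φ ∧ₘ ψ) = Intensional φ × Intensional ψ
Intensional (□ φ)    = ⊤

data PForm : Set where
  pv   : ℕ → PForm
  pneg : PForm → PForm
  pand : PForm → PForm → PForm

evalP : (ℕ → Bool) → PForm → Bool
evalP v (pv i)     = v i
evalP v (pneg p)   = not (evalP v p)
evalP v (pand p q) = evalP v p ∧ evalP v q

Tautology : PForm → Set
Tautology p = (v : ℕ → Bool) → evalP v p ≡ true

substP : (ℕ → MForm) → PForm → MForm
substP σ (pv i)     = σ i
substP σ (pneg p)   = ¬ₘ (substP σ p)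
substP σ (pand p q) = substP σ p ∧ₘ substP σ q

data S5CG+ (Ax : MForm → Set) : MForm → Set where
  taut   : ∀ p σ → Tautology p → S5CG+ Ax (substP σ p)
  axK    : ∀ A B → S5CG+ Ax ((□ (A ⇒ₘ B)) ⇒ₘ ((□ A) ⇒ₘ (□ B)))
  axT    : ∀ A → S5CG+ Ax ((□ A) ⇒ₘ A)
  ax5    : ∀ A → S5CG+ Ax ((◇ A) ⇒ₘ (□ (◇ A)))
  con    : ∀ y → S5CG+ Ax (¬ₘ (T y ∧ₘ F y))
  ground : ∀ y → S5CG+ Ax (((◇ (T y)) ∧ₘ (◇ (F y))) ⇒ₘ (◇ (Nₘ y)))
  extra  : ∀ A → Ax A → S5CG+ Ax A
  mp     : ∀ {A B} → S5CG+ Ax (A ⇒ₘ B) → S5CG+ Ax A → S5CG+ Ax B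
  nec    : ∀ {A} → S5CG+ Ax A → S5CG+ Ax (□ A)

NoAx : MForm → Set
NoAx _ = ⊥

⊢_ : MForm → Set
⊢ φ = S5CG+ NoAx φ

ConsistentWith : MForm → Set
ConsistentWith φ = ¬ Σ MForm (λ ψ → S5CG+ (λ A → A ≡ φ) ψ × S5CG+ (λ A → A ≡ φ) (¬ₘ ψ))

InΓ : MForm → Set
InΓ φ = Intensional φ × OnlyVarX φ

Isolator : MForm → Set
Isolator φ =
  ConsistentWith φ × InΓ φ
  × ((ψ : MForm) → InΓ ψ → (⊢ (φ ⇒ₘ ψ)) ⊎ (⊢ (φ ⇒ₘ (¬ₘ ψ))))

FIXDefinable : (Sentence → Set₁) → Set₁
FIXDefinable 𝒜 = Σ MForm (λ φ → OnlyVarX φ × Defines φ 𝒜)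

-- The truth of a formula in x at a fixed point depends only on the value of x⋆ there
-- and on the profile of x⋆: the set of values it takes across FIX. A realized profile
-- is nonempty and grounded (it contains "neither" whenever it contains "true" and
-- "false"), because the least fixed point lies below every fixed point. For each such
-- profile q the formula describe q, listing which values are possible, is an isolator:
-- it is consistent because S5[Con,Ground] is sound for the three-point model of q, and
-- it decides every intensional formula, since under it every formula is necessarily
-- determined by the current value of x. A definable set is therefore defined by the
-- disjunction of the descriptions of those profiles at which its defining formula holds.

{-# OPTIONS --safe #-}
module Submission where

open import Defs
open import Level using (0ℓ; lower) renaming (suc to lsuc)
open import Axiom.ExcludedMiddle using (ExcludedMiddle)
open import Data.Bool using (Bool; true; false; not; _∧_; _∨_) renaming (T to IsTrue)
open import Data.Bool.ListAction using (any)
open import Data.Bool.Properties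
  using (T-≡; T-not-≡; T-∧; ∧-identityʳ; ∧-zeroʳ; ∧-inverseʳ; ∨-identityʳ; not-involutive)
open import Data.Empty using (⊥; ⊥-elim)
open import Data.Fin using (Fin; toℕ) renaming (zero to fzero; suc to fsuc)
open import Data.List using (List; []; _∷_; map; filterᵇ)
open import Data.List.Membership.Propositional using (_∈_)
open import Data.List.Relation.Unary.All using (All; []; _∷_)
import Data.List.Relation.Unary.All as All
open import Data.List.Relation.Unary.All.Properties using (map⁺; filter⁺)
open import Data.List.Relation.Unary.Any using (here; there)
open import Data.Nat using (ℕ; zero; suc)
open import Data.Product using (Σ; ∃; _×_; _,_; proj₁; proj₂)
open import Data.Product.Function.NonDependent.Propositional using (_×-⇔_)
open import Data.Sum using (_⊎_; inj₁; inj₂)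
open import Data.Unit using (tt)
open import Data.Vec using (Vec; []; _∷_; lookup; tabulate)
open import Data.Vec.Properties using (lookup∘tabulate)
open import Function using (_∘_)
open import Function.Bundles using (_⇔_; mk⇔; Equivalence)
open import Function.Properties.Equivalence using () renaming (trans to ⇔-trans; sym to ⇔-sym)
open import Function.Related.Propositional using (module EquationalReasoning; equivalence)
open import Function.Related.TypeIsomorphisms using (¬-cong-⇔)
open import Relation.Binary.PropositionalEquality
  using (_≡_; refl; sym; trans; cong; cong₂; subst; module ≡-Reasoning)
open import Relation.Nullary using (¬_; Dec; yes; no; isYes)
open import Relation.Nullary.Decidable using (T?; toWitness; fromWitness)
open import Relation.Unary using (_⊆_)

open Equivalence using (to; from)

private
  variable
    Ax : MForm → Set
    A B C D H χ : MForm

-- Propositional tautologies, checked by truth tables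

data Schema (n : ℕ) : Set where
  var : Fin n → Schema n
  ~_  : Schema n → Schema n
  _&_ : Schema n → Schema n → Schema n

infix  7 ~_
infixr 6 _&_
infixr 5 _⟹_

_⟹_ : ∀ {n} → Schema n → Schema n → Schema n
p ⟹ q = ~ (p & ~ q)

pattern P₁ = var fzero
pattern P₂ = var (fsuc fzero)
pattern P₃ = var (fsuc (fsuc fzero))
pattern P₄ = var (fsuc (fsuc (fsuc fzero)))

evalSchema : ∀ {n} → Vec Bool n → Schema n → Bool
evalSchema v (var i) = lookup v i
evalSchema v (~ p)   = not (evalSchema v p)
evalSchema v (p & q) = evalSchema v p ∧ evalSchema v q

_[_] : ∀ {n} → Schema n → Vec MForm n → MForm
var i   [ σ ] = lookup σ i
(~ p)   [ σ ] = ¬ₘ (p [ σ ])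
(p & q) [ σ ] = (p [ σ ]) ∧ₘ (q [ σ ])

allValuations : ∀ n → (Vec Bool n → Bool) → Bool
allValuations zero    f = f []
allValuations (suc n) f = allValuations n (f ∘ (true ∷_)) ∧ allValuations n (f ∘ (false ∷_))

allValuations-sound : ∀ n f → IsTrue (allValuations n f) → ∀ v → IsTrue (f v)
allValuations-sound zero    f ok []          = ok
allValuations-sound (suc n) f ok (true ∷ v)  = allValuations-sound n _ (proj₁ (to T-∧ ok)) v
allValuations-sound (suc n) f ok (false ∷ v) = allValuations-sound n _ (proj₂ (to T-∧ ok)) v

IsTautology : ∀ {n} → Schema n → Set
IsTautology {n} p = IsTrue (allValuations n (λ v → evalSchema v p))

toPForm : ∀ {n} → Schema n → PForm
toPForm (var i) = pv (toℕ i)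
toPForm (~ p)   = pneg (toPForm p)
toPForm (p & q) = pand (toPForm p) (toPForm q)

evalP-toPForm : ∀ {n} (v : ℕ → Bool) (p : Schema n) →
  evalP v (toPForm p) ≡ evalSchema (tabulate (v ∘ toℕ)) p
evalP-toPForm v (var i) = sym (lookup∘tabulate (v ∘ toℕ) i)
evalP-toPForm v (~ p)   = cong not (evalP-toPForm v p)
evalP-toPForm v (p & q) = cong₂ _∧_ (evalP-toPForm v p) (evalP-toPForm v q)

-- Out-of-range indices never occur: toPForm only produces variables below n.
lookupℕ : ∀ {n} → Vec MForm n → ℕ → MForm
lookupℕ []      _       = ⊥ₘ
lookupℕ (A ∷ σ) zero    = A
lookupℕ (A ∷ σ) (suc k) = lookupℕ σ k

lookupℕ-toℕ : ∀ {n} (σ : Vec MForm n) i → lookupℕ σ (toℕ i) ≡ lookup σ i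
lookupℕ-toℕ (A ∷ σ) fzero    = refl
lookupℕ-toℕ (A ∷ σ) (fsuc i) = lookupℕ-toℕ σ i

substP-toPForm : ∀ {n} (σ : Vec MForm n) p → substP (lookupℕ σ) (toPForm p) ≡ p [ σ ]
substP-toPForm σ (var i) = lookupℕ-toℕ σ i
substP-toPForm σ (~ p)   = cong ¬ₘ_ (substP-toPForm σ p)
substP-toPForm σ (p & q) = cong₂ _∧ₘ_ (substP-toPForm σ p) (substP-toPForm σ q)

tautology : ∀ {n} (p : Schema n) {_ : IsTautology p} (σ : Vec MForm n) → S5CG+ Ax (p [ σ ])
tautology {n = n} p {p-taut} σ =
  subst (S5CG+ _) (substP-toPForm σ p) (taut (toPForm p) (lookupℕ σ) valid)
  where
  valid : Tautology (toPForm p)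
  valid v = trans (evalP-toPForm v p)
    (to T-≡ (allValuations-sound n (λ u → evalSchema u p) p-taut (tabulate (v ∘ toℕ))))

⇒-trans : S5CG+ Ax (A ⇒ₘ B) → S5CG+ Ax (B ⇒ₘ C) → S5CG+ Ax (A ⇒ₘ C)
⇒-trans {A = A} {B} {C} ab bc =
  mp (mp (tautology ((P₁ ⟹ P₂) ⟹ (P₂ ⟹ P₃) ⟹ (P₁ ⟹ P₃)) (A ∷ B ∷ C ∷ [])) ab) bc

contrapose : S5CG+ Ax (A ⇒ₘ B) → S5CG+ Ax ((¬ₘ B) ⇒ₘ (¬ₘ A))
contrapose {A = A} {B} = mp (tautology ((P₁ ⟹ P₂) ⟹ (~ P₂ ⟹ ~ P₁)) (A ∷ B ∷ []))

□-mono : S5CG+ Ax (A ⇒ₘ B) → S5CG+ Ax ((□ A) ⇒ₘ (□ B))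
□-mono {A = A} {B} d = mp (axK A B) (nec d)

negativeIntrospection : ∀ A → S5CG+ Ax ((¬ₘ (□ A)) ⇒ₘ (□ (¬ₘ (□ A))))
negativeIntrospection A =
  ⇒-trans (contrapose (□-mono (tautology (~ ~ P₁ ⟹ P₁) (A ∷ []))))
    (⇒-trans (ax5 (¬ₘ A)) (□-mono (contrapose (□-mono (tautology (P₁ ⟹ ~ ~ P₁) (A ∷ []))))))

positiveIntrospection : ∀ A → S5CG+ Ax ((□ A) ⇒ₘ (□ (□ A)))
positiveIntrospection A =
  ⇒-trans (mp (tautology ((P₁ ⟹ ~ P₂) ⟹ (P₂ ⟹ ~ P₁)) (□ (¬ₘ (□ A)) ∷ □ A ∷ [])) (axT (¬ₘ (□ A))))
    (⇒-trans (ax5 (□ A)) (□-mono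
      (mp (tautology ((~ P₁ ⟹ P₂) ⟹ (~ P₂ ⟹ P₁)) (□ A ∷ □ (¬ₘ (□ A)) ∷ [])) (negativeIntrospection A))))

infix 4 ⊢[_]_

⊢[_]_ : MForm → MForm → Set
⊢[ H ] A = ⊢ (H ⇒ₘ A)

weaken : ⊢ A → ⊢[ H ] A
weaken {A = A} {H} = mp (tautology (P₁ ⟹ P₂ ⟹ P₁) (A ∷ H ∷ []))

mpᴴ : ⊢[ H ] (A ⇒ₘ B) → ⊢[ H ] A → ⊢[ H ] B
mpᴴ {H = H} {A} {B} hab ha =
  mp (mp (tautology ((P₁ ⟹ P₂ ⟹ P₃) ⟹ (P₁ ⟹ P₂) ⟹ (P₁ ⟹ P₃)) (H ∷ A ∷ B ∷ [])) hab) ha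

apply : ⊢ (A ⇒ₘ B) → ⊢[ H ] A → ⊢[ H ] B
apply ab ha = ⇒-trans ha ab

apply₂ : ⊢ (A ⇒ₘ (B ⇒ₘ C)) → ⊢[ H ] A → ⊢[ H ] B → ⊢[ H ] C
apply₂ abc ha hb = mpᴴ (apply abc ha) hb

□-apply : ⊢ (A ⇒ₘ B) → ⊢[ H ] (□ A) → ⊢[ H ] (□ B)
□-apply ab = apply (□-mono ab)

□-apply₂ : ⊢ (A ⇒ₘ (B ⇒ₘ C)) → ⊢[ H ] (□ A) → ⊢[ H ] (□ B) → ⊢[ H ] (□ C)
□-apply₂ {B = B} {C} abc ha hb = mpᴴ (apply (axK B C) (□-apply abc ha)) hb

□-apply₃ : ⊢ (A ⇒ₘ (B ⇒ₘ (C ⇒ₘ D))) → ⊢[ H ] (□ A) → ⊢[ H ] (□ B) → ⊢[ H ] (□ C) → ⊢[ H ] (□ D)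
□-apply₃ {C = C} {D} abcd ha hb hc = mpᴴ (apply (axK C D) (□-apply₂ abcd ha hb)) hc

under : ⊢ (A ⇒ₘ B) → ⊢ ((C ⇒ₘ A) ⇒ₘ (C ⇒ₘ B))
under {A = A} {B} {C} = mp (tautology ((P₁ ⟹ P₂) ⟹ (P₃ ⟹ P₁) ⟹ (P₃ ⟹ P₂)) (A ∷ B ∷ C ∷ []))

under₂ : ⊢ (A ⇒ₘ (B ⇒ₘ C)) → ⊢ ((D ⇒ₘ A) ⇒ₘ ((D ⇒ₘ B) ⇒ₘ (D ⇒ₘ C)))
under₂ {A = A} {B} {C} {D} =
  mp (tautology ((P₁ ⟹ P₂ ⟹ P₃) ⟹ (P₄ ⟹ P₁) ⟹ (P₄ ⟹ P₂) ⟹ (P₄ ⟹ P₃)) (A ∷ B ∷ C ∷ D ∷ []))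

refute : ⊢[ H ] (◇ A) → ⊢[ H ] (□ (A ⇒ₘ (¬ₘ χ))) → ⊢[ H ] (¬ₘ (□ χ))
refute {A = A} {χ = χ} possible excludes =
  apply₂ (tautology ((P₁ ⟹ P₂) ⟹ ~ P₂ ⟹ ~ P₁) (□ χ ∷ □ (¬ₘ A) ∷ []))
    (apply (axK χ (¬ₘ A)) (□-apply (tautology ((P₁ ⟹ ~ P₂) ⟹ (P₂ ⟹ ~ P₁)) (A ∷ χ ∷ [])) excludes))
    possible

signed : Bool → MForm → MForm
signed true  φ = φ
signed false φ = ¬ₘ φ

signed-¬ : ∀ b φ → ⊢ (signed b φ ⇒ₘ signed (not b) (¬ₘ φ))
signed-¬ true  φ = tautology (P₁ ⟹ ~ ~ P₁) (φ ∷ [])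
signed-¬ false φ = tautology (P₁ ⟹ P₁) (¬ₘ φ ∷ [])

signed-∧ : ∀ b c φ ψ → ⊢ (signed b φ ⇒ₘ (signed c ψ ⇒ₘ signed (b ∧ c) (φ ∧ₘ ψ)))
signed-∧ true  true  φ ψ = tautology (P₁ ⟹ P₂ ⟹ (P₁ & P₂)) (φ ∷ ψ ∷ [])
signed-∧ true  false φ ψ = tautology (P₁ ⟹ ~ P₂ ⟹ ~ (P₁ & P₂)) (φ ∷ ψ ∷ [])
signed-∧ false c     φ ψ = tautology (~ P₁ ⟹ P₃ ⟹ ~ (P₁ & P₂)) (φ ∷ ψ ∷ signed c ψ ∷ [])

signed-introspection : ∀ b φ → ⊢ (signed b (□ φ) ⇒ₘ (□ (signed b (□ φ))))
signed-introspection true  = positiveIntrospection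
signed-introspection false = negativeIntrospection

signed-cases : ∀ b → ⊢[ H ] signed b A → (⊢[ H ] A) ⊎ (⊢[ H ] (¬ₘ A))
signed-cases true  = inj₁
signed-cases false = inj₂

-- Three-point models given by a profile

data Value : Set where
  vT vF vN : Value

xIs : Value → MForm
xIs vT = T x
xIs vF = F x
xIs vN = Nₘ x

isT isF : Value → Bool
isT vT = true
isT _  = false
isF vF = true
isF _  = false

Profile : Set
Profile = Bool × Bool × Bool

infix  6 _∋_
infixr 5 _⇒ᵇ_
infix  5 _⊨_

_∋_ : Profile → Value → Bool
(a , _ , _) ∋ vT = a
(_ , b , _) ∋ vF = b
(_ , _ , c) ∋ vN = c

profileOf : (Value → Bool) → Profile
profileOf g = g vT , g vF , g vN

profileOf-∋ : ∀ g u → profileOf g ∋ u ≡ g u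
profileOf-∋ g vT = refl
profileOf-∋ g vF = refl
profileOf-∋ g vN = refl

_⇒ᵇ_ : Bool → Bool → Bool
a ⇒ᵇ b = not (a ∧ not b)

everyIn : Profile → (Value → Bool) → Bool
everyIn q g = (q ∋ vT ⇒ᵇ g vT) ∧ ((q ∋ vF ⇒ᵇ g vF) ∧ (q ∋ vN ⇒ᵇ g vN))

-- Variables other than x are interpreted as constantly neither, which validates Con
-- and Ground for them.
valueOf : ℕ → Value → Value
valueOf zero    u = u
valueOf (suc _) _ = vN

eval : Profile → Value → MForm → Bool
eval q u (T y)    = isT (valueOf y u)
eval q u (F y)    = isF (valueOf y u)
eval q u (¬ₘ φ)   = not (eval q u φ)
eval q u (φ ∧ₘ ψ) = eval q u φ ∧ eval q u ψ
eval q u (□ φ)    = everyIn q (λ v → eval q v φ)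

_⊨_ : Profile → MForm → Bool
q ⊨ φ = everyIn q (λ u → eval q u φ)

Grounded : Profile → Set
Grounded q = IsTrue (q ∋ vT) → IsTrue (q ∋ vF) → IsTrue (q ∋ vN)

Admissible : Profile → Set
Admissible q = ∃ (λ u → IsTrue (q ∋ u)) × Grounded q

T-not : ∀ {b} → IsTrue (not b) ⇔ (¬ IsTrue b)
T-not {true}  = mk⇔ (λ ()) (λ ¬t → ¬t tt)
T-not {false} = mk⇔ (λ _ ()) (λ _ → tt)

T-⇒ᵇ : ∀ a b → IsTrue (a ⇒ᵇ b) ⇔ (IsTrue a → IsTrue b)
T-⇒ᵇ true  true  = mk⇔ (λ _ _ → tt) (λ _ → tt)
T-⇒ᵇ true  false = mk⇔ (λ ()) (λ f → f tt)
T-⇒ᵇ false _     = mk⇔ (λ _ ()) (λ _ → tt)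

T-∧₃ : ∀ a b c → IsTrue (a ∧ (b ∧ c)) ⇔ (IsTrue a × IsTrue b × IsTrue c)
T-∧₃ true  true  true  = mk⇔ (λ _ → tt , tt , tt) (λ _ → tt)
T-∧₃ true  true  false = mk⇔ (λ ()) (λ ())
T-∧₃ true  false _     = mk⇔ (λ ()) (λ ())
T-∧₃ false _     _     = mk⇔ (λ ()) (λ ())

everyIn-T : ∀ q g → IsTrue (everyIn q g) ⇔ (∀ u → IsTrue (q ∋ u) → IsTrue (g u))
everyIn-T q g =
  mk⇔ pointwise (λ h → from conjuncts (from (at vT) (h vT) , from (at vF) (h vF) , from (at vN) (h vN)))
  where
  at : ∀ u → IsTrue (q ∋ u ⇒ᵇ g u) ⇔ (IsTrue (q ∋ u) → IsTrue (g u))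
  at u = T-⇒ᵇ (q ∋ u) (g u)
  conjuncts : IsTrue (everyIn q g) ⇔
    (IsTrue (q ∋ vT ⇒ᵇ g vT) × IsTrue (q ∋ vF ⇒ᵇ g vF) × IsTrue (q ∋ vN ⇒ᵇ g vN))
  conjuncts = T-∧₃ (q ∋ vT ⇒ᵇ g vT) (q ∋ vF ⇒ᵇ g vF) (q ∋ vN ⇒ᵇ g vN)
  pointwise : IsTrue (everyIn q g) → ∀ u → IsTrue (q ∋ u) → IsTrue (g u)
  pointwise h vT = to (at vT) (proj₁ (to conjuncts h))
  pointwise h vF = to (at vF) (proj₁ (proj₂ (to conjuncts h)))
  pointwise h vN = to (at vN) (proj₂ (proj₂ (to conjuncts h)))

everyIn-cong : ∀ q {g h} → (∀ u → g u ≡ h u) → everyIn q g ≡ everyIn q h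
everyIn-cong q g≡h =
  cong₂ _∧_ (cong (q ∋ vT ⇒ᵇ_) (g≡h vT))
    (cong₂ _∧_ (cong (q ∋ vF ⇒ᵇ_) (g≡h vF)) (cong (q ∋ vN ⇒ᵇ_) (g≡h vN)))

everyIn-const : ∀ q → ∃ (λ u → IsTrue (q ∋ u)) → ∀ b → everyIn q (λ _ → b) ≡ b
everyIn-const q _         true  = to T-≡ (from (everyIn-T q _) (λ _ _ → tt))
everyIn-const q (u , u∈q) false = to T-not-≡ (from T-not (λ all → to (everyIn-T q _) all u u∈q))

eval-substP : ∀ q u σ p → eval q u (substP σ p) ≡ evalP (λ i → eval q u (σ i)) p
eval-substP q u σ (pv i)     = refl
eval-substP q u σ (pneg p)   = cong not (eval-substP q u σ p)
eval-substP q u σ (pand p r) = cong₂ _∧_ (eval-substP q u σ p) (eval-substP q u σ r)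

not-true-and-false : ∀ u → IsTrue (not (isT u ∧ isF u))
not-true-and-false vT = tt
not-true-and-false vF = tt
not-true-and-false vN = tt

ground-x-valid : ∀ q u → Grounded q → IsTrue (eval q u (((◇ (T x)) ∧ₘ (◇ (F x))) ⇒ₘ (◇ (Nₘ x))))
ground-x-valid (true  , true  , false) u grounded = grounded tt tt
ground-x-valid (true  , true  , true ) u _ = tt
ground-x-valid (true  , false , true ) u _ = tt
ground-x-valid (true  , false , false) u _ = tt
ground-x-valid (false , true  , true ) u _ = tt
ground-x-valid (false , true  , false) u _ = tt
ground-x-valid (false , false , true ) u _ = tt
ground-x-valid (false , false , false) u _ = tt

sound : ∀ {q} → Grounded q → (∀ {A} → Ax A → IsTrue (q ⊨ A)) → S5CG+ Ax A → IsTrue (q ⊨ A)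
sound {Ax = Ax} {A = A} {q = q} grounded axioms d = from (⊨-T A) (holds d)
  where
  ⊨-T : ∀ A → IsTrue (q ⊨ A) ⇔ (∀ u → IsTrue (q ∋ u) → IsTrue (eval q u A))
  ⊨-T A = everyIn-T q (λ u → eval q u A)
  ⇒-T : ∀ u A B → IsTrue (eval q u (A ⇒ₘ B)) ⇔ (IsTrue (eval q u A) → IsTrue (eval q u B))
  ⇒-T u A B = T-⇒ᵇ (eval q u A) (eval q u B)
  holds : ∀ {B} → S5CG+ Ax B → ∀ u → IsTrue (q ∋ u) → IsTrue (eval q u B)
  holds (taut p σ p-taut) u _ = subst IsTrue (sym (eval-substP q u σ p)) (from T-≡ (p-taut _))
  holds (axK A B) u _ =
    from (⇒-T u (□ (A ⇒ₘ B)) ((□ A) ⇒ₘ (□ B))) λ □A⇒B →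
    from (⇒-T u (□ A) (□ B)) λ □A →
    from (⊨-T B) λ v v∈q →
      to (⇒-T v A B) (to (⊨-T (A ⇒ₘ B)) □A⇒B v v∈q) (to (⊨-T A) □A v v∈q)
  holds (axT A) u u∈q = from (⇒-T u (□ A) A) λ □A → to (⊨-T A) □A u u∈q
  holds (ax5 A) u _ = from (⇒-T u (◇ A) (□ (◇ A))) λ ◇A → from (⊨-T (◇ A)) λ _ _ → ◇A
  holds (con y) u _ = not-true-and-false (valueOf y u)
  holds (ground zero) u _ = ground-x-valid q u grounded
  holds (ground (suc k)) u _ =
    from (⇒-T u ((◇ (T (suc k))) ∧ₘ (◇ (F (suc k)))) (◇ (Nₘ (suc k)))) λ ◇T∧◇F →
      ⊥-elim (to T-not (proj₂ (to T-∧ ◇T∧◇F)) (from (⊨-T (¬ₘ (F (suc k)))) λ _ _ → tt))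
  holds (extra A a) u u∈q = to (⊨-T A) (axioms a) u u∈q
  holds (mp {A = A} {B = B} d e) u u∈q = to (⇒-T u A B) (holds d u u∈q) (holds e u u∈q)
  holds (nec {A = A} d) u _ = from (⊨-T A) (holds d)

-- Descriptions of profiles are isolators

describeValue : Bool → Value → MForm
describeValue true  u = ◇ (xIs u)
describeValue false u = □ (¬ₘ (xIs u))

describe : Profile → MForm
describe q = describeValue (q ∋ vT) vT ∧ₘ (describeValue (q ∋ vF) vF ∧ₘ describeValue (q ∋ vN) vN)

describe-holds : ∀ q → IsTrue (q ⊨ describe q)
describe-holds (true  , true  , true ) = tt
describe-holds (true  , true  , false) = tt
describe-holds (true  , false , true ) = tt
describe-holds (true  , false , false) = tt
describe-holds (false , true  , true ) = tt
describe-holds (false , true  , false) = tt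
describe-holds (false , false , true ) = tt
describe-holds (false , false , false) = tt

describe-consistent : ∀ {q} → Admissible q → ConsistentWith (describe q)
describe-consistent {q} ((u , u∈q) , grounded) (ψ , ⊢ψ , ⊢¬ψ) = to T-not (holds ⊢¬ψ) (holds ⊢ψ)
  where
  holds : S5CG+ (_≡ describe q) A → IsTrue (eval q u A)
  holds {A} d =
    to (everyIn-T q (λ v → eval q v A)) (sound grounded (λ { refl → describe-holds q }) d) u u∈q

xIs-onlyX : ∀ u → OnlyVarX (xIs u)
xIs-onlyX vT = refl
xIs-onlyX vF = refl
xIs-onlyX vN = refl , refl

describeValue-InΓ : ∀ b u → InΓ (describeValue b u)
describeValue-InΓ true  u = _ , xIs-onlyX u
describeValue-InΓ false u = _ , xIs-onlyX u

describe-InΓ : ∀ q → InΓ (describe q)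
describe-InΓ q =
  (proj₁ (at vT) , proj₁ (at vF) , proj₁ (at vN)) , (proj₂ (at vT) , proj₂ (at vF) , proj₂ (at vN))
  where
  at : ∀ u → InΓ (describeValue (q ∋ u) u)
  at u = describeValue-InΓ (q ∋ u) u

describe-component : ∀ q u → ⊢[ describe q ] describeValue (q ∋ u) u
describe-component q vT = tautology ((P₁ & P₂ & P₃) ⟹ P₁) (_ ∷ _ ∷ _ ∷ [])
describe-component q vF = tautology ((P₁ & P₂ & P₃) ⟹ P₂) (_ ∷ _ ∷ _ ∷ [])
describe-component q vN = tautology ((P₁ & P₂ & P₃) ⟹ P₃) (_ ∷ _ ∷ _ ∷ [])

T-decided : ∀ u → ⊢ (xIs u ⇒ₘ signed (isT u) (T x))
T-decided vT = tautology (P₁ ⟹ P₁) (T x ∷ [])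
T-decided vF = mp (tautology (~ (P₁ & P₂) ⟹ (P₂ ⟹ ~ P₁)) (T x ∷ F x ∷ [])) (con x)
T-decided vN = tautology ((~ P₁ & ~ P₂) ⟹ ~ P₁) (T x ∷ F x ∷ [])

F-decided : ∀ u → ⊢ (xIs u ⇒ₘ signed (isF u) (F x))
F-decided vT = mp (tautology (~ (P₁ & P₂) ⟹ (P₁ ⟹ ~ P₂)) (T x ∷ F x ∷ [])) (con x)
F-decided vF = tautology (P₁ ⟹ P₁) (F x ∷ [])
F-decided vN = tautology ((~ P₁ & ~ P₂) ⟹ ~ P₂) (T x ∷ F x ∷ [])

□-exhaust : ⊢[ H ] (□ (T x ⇒ₘ χ)) → ⊢[ H ] (□ (F x ⇒ₘ χ)) → ⊢[ H ] (□ (Nₘ x ⇒ₘ χ)) → ⊢[ H ] (□ χ)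
□-exhaust {χ = χ} =
  □-apply₃ (tautology ((P₁ ⟹ P₃) ⟹ (P₂ ⟹ P₃) ⟹ ((~ P₁ & ~ P₂) ⟹ P₃) ⟹ P₃) (T x ∷ F x ∷ χ ∷ []))

module _ (q : Profile) where

  -- What the value u contributes to deciding □ χ under describe q: either χ holds
  -- whenever x has value u, or u is a possible value refuting χ, so that □ χ fails.
  Verdict : Value → Bool → MForm → Set
  Verdict u true  χ = ⊢[ describe q ] (□ (xIs u ⇒ₘ χ))
  Verdict u false χ = ⊢[ describe q ] (¬ₘ (□ χ))

  verdict : ∀ u b χ → ⊢[ describe q ] (□ (xIs u ⇒ₘ signed b χ)) → Verdict u (q ∋ u ⇒ᵇ b) χ
  verdict u true χ k with q ∋ u
  ... | true  = k
  ... | false = k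
  verdict u false χ k with q ∋ u | describe-component q u
  ... | true  | possible   = refute possible k
  ... | false | impossible = □-apply (tautology (~ P₁ ⟹ P₁ ⟹ P₂) (xIs u ∷ χ ∷ [])) impossible

  □-signed : ∀ b₁ b₂ b₃ → Verdict vT b₁ χ → Verdict vF b₂ χ → Verdict vN b₃ χ →
    ⊢[ describe q ] signed (b₁ ∧ (b₂ ∧ b₃)) (□ χ)
  □-signed true  true  true  kT kF kN = □-exhaust kT kF kN
  □-signed true  true  false _  _  refuted = refuted
  □-signed true  false _     _  refuted _ = refuted
  □-signed false _     _     refuted _ _ = refuted

  box-decided : ∀ g χ → (∀ u → ⊢[ describe q ] (□ (xIs u ⇒ₘ signed (g u) χ))) →
    ⊢[ describe q ] signed (everyIn q g) (□ χ)
  box-decided g χ k =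
    □-signed _ _ _ (verdict vT (g vT) χ (k vT)) (verdict vF (g vF) χ (k vF)) (verdict vN (g vN) χ (k vN))

  locally-decided : ∀ χ → OnlyVarX χ → ∀ u → ⊢[ describe q ] (□ (xIs u ⇒ₘ signed (eval q u χ) χ))
  locally-decided (T _) refl u = weaken (nec (T-decided u))
  locally-decided (F _) refl u = weaken (nec (F-decided u))
  locally-decided (¬ₘ χ) onlyX u = □-apply (under (signed-¬ _ χ)) (locally-decided χ onlyX u)
  locally-decided (χ ∧ₘ ψ) (onlyX , onlyX′) u =
    □-apply₂ (under₂ (signed-∧ _ _ χ ψ)) (locally-decided χ onlyX u) (locally-decided ψ onlyX′ u)
  locally-decided (□ χ) onlyX u =
    □-apply (tautology (P₁ ⟹ P₂ ⟹ P₁) (_ ∷ xIs u ∷ []))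
      (apply (signed-introspection _ χ) (box-decided _ χ (locally-decided χ onlyX)))

  decided : ∀ ψ → InΓ ψ → ∀ u → ⊢[ describe q ] signed (eval q u ψ) ψ
  decided (T _) (() , _) u
  decided (F _) (() , _) u
  decided (¬ₘ ψ) (intensional , onlyX) u = apply (signed-¬ _ ψ) (decided ψ (intensional , onlyX) u)
  decided (ψ ∧ₘ ψ′) ((intensional , intensional′) , (onlyX , onlyX′)) u =
    apply₂ (signed-∧ _ _ ψ ψ′)
      (decided ψ (intensional , onlyX) u) (decided ψ′ (intensional′ , onlyX′) u)
  decided (□ χ) (_ , onlyX) u = box-decided _ χ (locally-decided χ onlyX)

-- The choice of vN is arbitrary: an intensional formula has the same value at every point.
describe-isolator : ∀ {q} → Admissible q → Isolator (describe q)
describe-isolator {q} admissible =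
  describe-consistent admissible , describe-InΓ q , λ ψ ψ∈Γ → signed-cases _ (decided q ψ ψ∈Γ vN)

mutual
  Tr-mono : ∀ {S S′ : ℕ → Set} → S ⊆ S′ → ∀ {n} (ρ : Env n) φ → Tr S ρ φ → Tr S′ ρ φ
  Tr-mono S⊆S′ ρ (eq t u)   t≡u         = t≡u
  Tr-mono S⊆S′ ρ (True t)   t∈S         = S⊆S′ t∈S
  Tr-mono S⊆S′ ρ (neg φ)    fa          = Fa-mono S⊆S′ ρ φ fa
  Tr-mono S⊆S′ ρ (conj φ ψ) (trφ , trψ) = Tr-mono S⊆S′ ρ φ trφ , Tr-mono S⊆S′ ρ ψ trψ
  Tr-mono S⊆S′ ρ (all φ)    tr          = λ m → Tr-mono S⊆S′ (m ∷ᵉ ρ) φ (tr m)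

  Fa-mono : ∀ {S S′ : ℕ → Set} → S ⊆ S′ → ∀ {n} (ρ : Env n) φ → Fa S ρ φ → Fa S′ ρ φ
  Fa-mono S⊆S′ ρ (eq t u)   t≢u                     = t≢u
  Fa-mono S⊆S′ ρ (True t)   (inj₁ notCode)          = inj₁ notCode
  Fa-mono S⊆S′ ρ (True t)   (inj₂ (ψ , ψ≡t , ¬ψ∈S)) = inj₂ (ψ , ψ≡t , S⊆S′ ¬ψ∈S)
  Fa-mono S⊆S′ ρ (neg φ)    tr                      = Tr-mono S⊆S′ ρ φ tr
  Fa-mono S⊆S′ ρ (conj φ ψ) (inj₁ faφ)              = inj₁ (Fa-mono S⊆S′ ρ φ faφ)
  Fa-mono S⊆S′ ρ (conj φ ψ) (inj₂ faψ)              = inj₂ (Fa-mono S⊆S′ ρ ψ faψ)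
  Fa-mono S⊆S′ ρ (all φ)    (m , fa)                = m , Fa-mono S⊆S′ (m ∷ᵉ ρ) φ fa

Tr-Fa-disjoint : ∀ {S} → IsFixedPoint S → ∀ {n} (ρ : Env n) φ → Tr S ρ φ → Fa S ρ φ → ⊥
Tr-Fa-disjoint fp ρ (eq t u)   t≡u       t≢u            = t≢u t≡u
Tr-Fa-disjoint fp ρ (True t)   t∈S       (inj₁ notCode) with to (proj₁ fp _) t∈S
... | φ , φ≡t , _ = notCode (φ , φ≡t)
Tr-Fa-disjoint {S} fp ρ (True t) t∈S (inj₂ (φ , φ≡t , ¬φ∈S)) =
  proj₂ fp φ (subst S (sym φ≡t) t∈S , ¬φ∈S)
Tr-Fa-disjoint fp ρ (neg φ)    fa        tr             = Tr-Fa-disjoint fp ρ φ tr fa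
Tr-Fa-disjoint fp ρ (conj φ ψ) (trφ , _) (inj₁ faφ)     = Tr-Fa-disjoint fp ρ φ trφ faφ
Tr-Fa-disjoint fp ρ (conj φ ψ) (_ , trψ) (inj₂ faψ)     = Tr-Fa-disjoint fp ρ ψ trψ faψ
Tr-Fa-disjoint fp ρ (all φ)    tr        (m , fa)       = Tr-Fa-disjoint fp (m ∷ᵉ ρ) φ (tr m) fa

jump : (ℕ → Set) → ℕ → Set
jump S m = Σ Sentence (λ φ → code φ ≡ m × TrueIn S φ)

jump-mono : ∀ {S S′ : ℕ → Set} → S ⊆ S′ → jump S ⊆ jump S′
jump-mono S⊆S′ (φ , φ≡m , tr) = φ , φ≡m , Tr-mono S⊆S′ emptyEnv φ tr

fixedPoint-closed : ∀ (w : FIX) → jump (proj₁ w) ⊆ proj₁ w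
fixedPoint-closed (S , fp) = from (proj₁ fp _)

module LeastFixedPoint (em : ExcludedMiddle (lsuc 0ℓ)) where

  -- The intersection of all jump-closed sets quantifies over Set; excluded middle
  -- at level 1 decides it, which brings the least fixed point back down to Set.
  least : ℕ → Set
  least m = IsTrue (isYes (em {∀ (S : ℕ → Set) → jump S ⊆ S → S m}))

  least-⊆ : ∀ {S} → jump S ⊆ S → least ⊆ S
  least-⊆ {S} closed m∈least = toWitness m∈least S closed

  jump-least⊆least : jump least ⊆ least
  jump-least⊆least j = fromWitness (λ S closed → closed (jump-mono (least-⊆ closed) j))

  least⊆jump-least : least ⊆ jump least
  least⊆jump-least = least-⊆ (jump-mono jump-least⊆least)

  least-⊆-FIX : ∀ (w : FIX) → least ⊆ proj₁ w
  least-⊆-FIX w = least-⊆ (fixedPoint-closed w)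

  leastFixedPoint : FIX → FIX
  leastFixedPoint w =
    least , (λ m → mk⇔ least⊆jump-least jump-least⊆least) ,
    λ φ (φ∈least , ¬φ∈least) → proj₂ (proj₂ w) φ (least-⊆-FIX w φ∈least , least-⊆-FIX w ¬φ∈least)

  least-undetermined : ∀ (w₁ w₂ : FIX) φ → TrueIn (proj₁ w₁) φ → FalseIn (proj₁ w₂) φ →
    ¬ TrueIn least φ × ¬ FalseIn least φ
  least-undetermined w₁ w₂ φ tr₁ fa₂ =
    (λ tr → Tr-Fa-disjoint (proj₂ w₂) emptyEnv φ (Tr-mono (least-⊆-FIX w₂) emptyEnv φ tr) fa₂) ,
    (λ fa → Tr-Fa-disjoint (proj₂ w₁) emptyEnv φ tr₁ (Fa-mono (least-⊆-FIX w₁) emptyEnv φ fa))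

module _ {a b} {X : Set a} {Y : Set b} where

  classify : Dec X → Dec Y → Value
  classify (yes _) _       = vT
  classify (no _)  (yes _) = vF
  classify (no _)  (no _)  = vN

  classify-T : (x? : Dec X) (y? : Dec Y) → IsTrue (isT (classify x? y?)) ⇔ X
  classify-T (yes x) _       = mk⇔ (λ _ → x) _
  classify-T (no ¬x) (yes _) = mk⇔ (λ ()) ¬x
  classify-T (no ¬x) (no _)  = mk⇔ (λ ()) ¬x

  classify-F : ¬ (X × Y) → (x? : Dec X) (y? : Dec Y) → IsTrue (isF (classify x? y?)) ⇔ Y
  classify-F disjoint (yes x) _       = mk⇔ (λ ()) (λ y → disjoint (x , y))
  classify-F _        (no _)  (yes y) = mk⇔ (λ _ → y) _
  classify-F _        (no _)  (no ¬y) = mk⇔ (λ ()) ¬y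

  classify-N : (x? : Dec X) (y? : Dec Y) → ¬ X → ¬ Y → classify x? y? ≡ vN
  classify-N (yes x) _       ¬x _  = ⊥-elim (¬x x)
  classify-N (no _)  (yes y) _  ¬y = ⊥-elim (¬y y)
  classify-N (no _)  (no _)  _  _  = refl

module Reduction (em : ExcludedMiddle (lsuc 0ℓ)) (⋆ : Realization) where
  open LeastFixedPoint em

  valueAt : FIX → Value
  valueAt w = classify (em {w ⊩[ ⋆ ] T x}) (em {w ⊩[ ⋆ ] F x})

  ⊩T⇔isT : ∀ w → (w ⊩[ ⋆ ] T x) ⇔ IsTrue (isT (valueAt w))
  ⊩T⇔isT w = ⇔-sym (classify-T _ _)

  ⊩F⇔isF : ∀ w → (w ⊩[ ⋆ ] F x) ⇔ IsTrue (isF (valueAt w))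
  ⊩F⇔isF (_ , fp) =
    ⇔-sym (classify-F (λ (tr , fa) → Tr-Fa-disjoint fp emptyEnv (⋆ x) (lower tr) (lower fa)) _ _)

  Occurs : Value → Set₁
  Occurs u = Σ FIX (λ w → valueAt w ≡ u)

  occurs : Value → Bool
  occurs u = isYes (em {Occurs u})

  realized : Profile
  realized = profileOf occurs

  realized-∋ : ∀ u → IsTrue (realized ∋ u) ⇔ Occurs u
  realized-∋ u = mk⇔ (toWitness ∘ subst IsTrue (profileOf-∋ occurs u))
                     (subst IsTrue (sym (profileOf-∋ occurs u)) ∘ fromWitness)

  realized-grounded : Grounded realized
  realized-grounded t f = grounded (to (realized-∋ vT) t) (to (realized-∋ vF) f)
    where
    grounded : Occurs vT → Occurs vF → IsTrue (realized ∋ vN)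
    grounded (w₁ , w₁-true) (w₂ , w₂-false) =
      from (realized-∋ vN) (leastFixedPoint w₁ , classify-N _ _ (¬tr ∘ lower) (¬fa ∘ lower))
      where
      tr₁ : TrueIn (proj₁ w₁) (⋆ x)
      tr₁ = lower (from (⊩T⇔isT w₁) (subst (IsTrue ∘ isT) (sym w₁-true) tt))
      fa₂ : FalseIn (proj₁ w₂) (⋆ x)
      fa₂ = lower (from (⊩F⇔isF w₂) (subst (IsTrue ∘ isF) (sym w₂-false) tt))
      ¬tr : ¬ TrueIn least (⋆ x)
      ¬tr = proj₁ (least-undetermined w₁ w₂ (⋆ x) tr₁ fa₂)
      ¬fa : ¬ FalseIn least (⋆ x)
      ¬fa = proj₂ (least-undetermined w₁ w₂ (⋆ x) tr₁ fa₂)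

  □-reduces : ∀ χ → (∀ w → (w ⊩[ ⋆ ] χ) ⇔ IsTrue (eval realized (valueAt w) χ)) →
    (FIX⊩[ ⋆ ] χ) ⇔ IsTrue (realized ⊨ χ)
  □-reduces χ pointwise =
    ⇔-trans (mk⇔ valid⇒ ⇒valid) (⇔-sym (everyIn-T realized (λ u → eval realized u χ)))
    where
    valid⇒ : FIX⊩[ ⋆ ] χ → ∀ u → IsTrue (realized ∋ u) → IsTrue (eval realized u χ)
    valid⇒ valid u u∈realized with to (realized-∋ u) u∈realized
    ... | w , refl = to (pointwise w) (valid w)
    ⇒valid : (∀ u → IsTrue (realized ∋ u) → IsTrue (eval realized u χ)) → FIX⊩[ ⋆ ] χ
    ⇒valid h w = from (pointwise w) (h (valueAt w) (from (realized-∋ (valueAt w)) (w , refl)))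

  ⊩⇔eval : ∀ χ → OnlyVarX χ → ∀ w → (w ⊩[ ⋆ ] χ) ⇔ IsTrue (eval realized (valueAt w) χ)
  ⊩⇔eval (T _) refl w = ⊩T⇔isT w
  ⊩⇔eval (F _) refl w = ⊩F⇔isF w
  ⊩⇔eval (¬ₘ χ) onlyX w = ⇔-trans (¬-cong-⇔ (⊩⇔eval χ onlyX w)) (⇔-sym T-not)
  ⊩⇔eval (χ ∧ₘ ψ) (onlyX , onlyX′) w = ⇔-trans (⊩⇔eval χ onlyX w ×-⇔ ⊩⇔eval ψ onlyX′ w) (⇔-sym T-∧)
  ⊩⇔eval (□ χ) onlyX w = □-reduces χ (⊩⇔eval χ onlyX)

  FIX⊩⇔⊨ : OnlyVarX χ → (FIX⊩[ ⋆ ] χ) ⇔ IsTrue (realized ⊨ χ)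
  FIX⊩⇔⊨ {χ} onlyX = □-reduces χ (⊩⇔eval χ onlyX)

-- Definability by disjunctions of descriptions

admissibleProfiles : List Profile
admissibleProfiles =
  (true , false , false) ∷ (false , true , false) ∷ (false , false , true) ∷
  (true , false , true) ∷ (false , true , true) ∷ (true , true , true) ∷ []

admissibleProfiles-admissible : All Admissible admissibleProfiles
admissibleProfiles-admissible =
  ((vT , tt) , λ _ ()) ∷ ((vF , tt) , λ ()) ∷ ((vN , tt) , λ _ _ → tt) ∷
  ((vT , tt) , λ _ _ → tt) ∷ ((vF , tt) , λ _ _ → tt) ∷ ((vT , tt) , λ _ _ → tt) ∷ []

grounded-cases : ∀ q → Grounded q → q ≡ (false , false , false) ⊎ q ∈ admissibleProfiles
grounded-cases (false , false , false) _        = inj₁ refl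
grounded-cases (true  , true  , false) grounded = ⊥-elim (grounded tt tt)
grounded-cases (true  , false , false) _        = inj₂ (here refl)
grounded-cases (false , true  , false) _        = inj₂ (there (here refl))
grounded-cases (false , false , true ) _        = inj₂ (there (there (here refl)))
grounded-cases (true  , false , true ) _        = inj₂ (there (there (there (here refl))))
grounded-cases (false , true  , true ) _        = inj₂ (there (there (there (there (here refl)))))
grounded-cases (true  , true  , true ) _        = inj₂ (there (there (there (there (there (here refl))))))

select : MForm → List MForm
select φ = map describe (filterᵇ (_⊨ φ) admissibleProfiles)

select-isolators : ∀ φ → All Isolator (select φ)
select-isolators φ =
  map⁺ (filter⁺ (T? ∘ (_⊨ φ)) (All.map describe-isolator admissibleProfiles-admissible))

not-∧-not : ∀ a b → not (not a ∧ not b) ≡ a ∨ b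
not-∧-not true  b = refl
not-∧-not false b = not-involutive b

eval-⋁ : ∀ q u φs → eval q u (⋁ φs) ≡ any (eval q u) φs
eval-⋁ q u []       = ∧-inverseʳ (isT u)
eval-⋁ q u (φ ∷ φs) =
  trans (not-∧-not (eval q u φ) (eval q u (⋁ φs))) (cong (eval q u φ ∨_) (eval-⋁ q u φs))

any-describe-filter : ∀ q u (f : Profile → Bool) qs →
  any (eval q u) (map describe (filterᵇ f qs)) ≡ any (λ q′ → eval q u (describe q′) ∧ f q′) qs
any-describe-filter q u f []         = refl
any-describe-filter q u f (q′ ∷ qs) with f q′
... | true  = cong₂ _∨_ (sym (∧-identityʳ _)) (any-describe-filter q u f qs)
... | false =
  trans (any-describe-filter q u f qs) (cong (_∨ _) (sym (∧-zeroʳ (eval q u (describe q′)))))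

any-describe-admissible : ∀ {q} → q ∈ admissibleProfiles → ∀ u (f : Profile → Bool) →
  any (λ q′ → eval q u (describe q′) ∧ f q′) admissibleProfiles ≡ f q
any-describe-admissible (here refl)                                          u f = ∨-identityʳ _
any-describe-admissible (there (here refl))                                  u f = ∨-identityʳ _
any-describe-admissible (there (there (here refl)))                          u f = ∨-identityʳ _
any-describe-admissible (there (there (there (here refl))))                  u f = ∨-identityʳ _
any-describe-admissible (there (there (there (there (here refl)))))          u f = ∨-identityʳ _
any-describe-admissible (there (there (there (there (there (here refl)))))) u f = ∨-identityʳ _

⊨-⋁-select : ∀ q → Grounded q → ∀ φ → q ⊨ ⋁ (select φ) ≡ q ⊨ φ
⊨-⋁-select q grounded φ with grounded-cases q grounded
... | inj₁ refl = refl
... | inj₂ q∈admissible = begin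
  everyIn q (λ u → eval q u (⋁ (select φ)))  ≡⟨ everyIn-cong q eval-⋁-select ⟩
  everyIn q (λ _ → q ⊨ φ)                     ≡⟨ everyIn-const q nonempty (q ⊨ φ) ⟩
  q ⊨ φ                                       ∎
  where
  open ≡-Reasoning
  nonempty : ∃ (λ u → IsTrue (q ∋ u))
  nonempty = proj₁ (All.lookup admissibleProfiles-admissible q∈admissible)
  eval-⋁-select : ∀ u → eval q u (⋁ (select φ)) ≡ q ⊨ φ
  eval-⋁-select u = begin
    eval q u (⋁ (select φ))
      ≡⟨ eval-⋁ q u (select φ) ⟩
    any (eval q u) (select φ)
      ≡⟨ any-describe-filter q u (_⊨ φ) admissibleProfiles ⟩
    any (λ q′ → eval q u (describe q′) ∧ (q′ ⊨ φ)) admissibleProfiles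
      ≡⟨ any-describe-admissible q∈admissible u (_⊨ φ) ⟩
    q ⊨ φ
      ∎

⋁-onlyX : ∀ {φs} → All OnlyVarX φs → OnlyVarX (⋁ φs)
⋁-onlyX []                = refl , refl
⋁-onlyX (onlyX ∷ onlyXs) = onlyX , ⋁-onlyX onlyXs

isolator-onlyX : Isolator A → OnlyVarX A
isolator-onlyX (_ , (_ , onlyX) , _) = onlyX

mainTheorem9 : ExcludedMiddle (lsuc 0ℓ) → (𝒜 : Sentence → Set₁) → FIXDefinable 𝒜 → Σ (List MForm) (λ φs → All Isolator φs × Defines (⋁ φs) 𝒜)
mainTheorem9 em 𝒜 (φ , onlyX , φ-defines) = select φ , select-isolators φ , defines
  where
  defines : Defines (⋁ (select φ)) 𝒜
  defines ⋆ = begin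
    FIX⊩[ ⋆ ] ⋁ (select φ)            ∼⟨ FIX⊩⇔⊨ (⋁-onlyX (All.map isolator-onlyX (select-isolators φ))) ⟩
    IsTrue (realized ⊨ ⋁ (select φ))  ≡⟨ cong IsTrue (⊨-⋁-select realized realized-grounded φ) ⟩
    IsTrue (realized ⊨ φ)              ∼⟨ ⇔-sym (FIX⊩⇔⊨ onlyX) ⟩
    FIX⊩[ ⋆ ] φ                        ∼⟨ φ-defines ⋆ ⟩
    𝒜 (⋆ x)                            ∎
    where
    open Reduction em ⋆
    open EquationalReasoning {k = equivalence}
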